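{- Let $A$ be an srl-monoid satisfying the identity $z\rightarrow (x\vee y) = (z\rightarrow x) \vee (z\rightarrow y)$. Then for all $a,b\in A^{ - }$, $\mathsf{C}[a\vee b] = \mathsf{C}[a] \cap \mathsf{C}[b]$.
   Context: A commutative l-monoid is an algebra $(A,\wedge,\vee,\cdot,e)$ of type $(2,2,2,0)$ such that $(A,\wedge,\vee)$ is a lattice, $(A,\cdot,e)$ is a commutative monoid and $(a\vee b)\cdot c=(a\cdot c)\vee(b\cdot c)$ for all $a,b,c\in A$. An algebra $(A,\wedge,\vee,\cdot,\rightarrow,e)$ of type $(2,2,2,2,0)$ is an srl-monoid if $(A,\wedge,\vee,\cdot,e)$ is a commutative l-monoid and there is a subalgebra $Q$ of $(A,\wedge,\vee,\cdot,e)$ such that for all $a,b\in A$ the set $\{q\in Q: a\cdot q\leq b\}$ has a maximum and $a\rightarrow b$ equals this maximum. $A^{ - }=\{a\in A: a\le e\}$. A convex subalgebra is a subalgebra $H$ of $(A,\wedge,\vee,\cdot,\rightarrow,e)$ such that $a,b\in H$, $a\le c\le b$ imply $c\in H$; it is strongly convex if for all $a\in A$, $h\in H$ with $a\cdot h\le e\le h\rightarrow a$ one has $a\in H$. $\mathsf{C}[a]$ is the smallest strongly convex subalgebra of $A$ containing $a$. -}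

module Defs where

open import Level using (Level; suc; _⊔_)
open import Data.Product using (_×_; Σ)
open import Relation.Binary.PropositionalEquality using (_≡_)
open import Algebra.Lattice.Structures using (IsLattice)
open import Algebra.Structures using (IsCommutativeMonoid)

-- The subalgebra Q of the l-monoid reduct witnessing the definition of →
-- is recorded as part of the structure (a field), together with the
-- property that a → b is the maximum of { q ∈ Q : a · q ≤ b }.
record SRLMonoid (ℓ : Level) : Set (suc ℓ) where
  infixr 6 _∨_
  infixr 7 _∧_
  infixr 8 _·_
  infixr 5 _⇒_
  infix 4 _≤_
  field
    Carrier : Set ℓ
    _∧_ _∨_ _·_ _⇒_ : Carrier → Carrier → Carrier
    e : Carrier
    isLattice : IsLattice _≡_ _∨_ _∧_
    isCommutativeMonoid : IsCommutativeMonoid _≡_ _·_ e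
    ·-distrib-∨ : ∀ a b c → (a ∨ b) · c ≡ (a · c) ∨ (b · c)

  _≤_ : Carrier → Carrier → Set ℓ
  a ≤ b = a ∧ b ≡ a

  field
    Q : Carrier → Set ℓ
    Q-∧ : ∀ {a b} → Q a → Q b → Q (a ∧ b)
    Q-∨ : ∀ {a b} → Q a → Q b → Q (a ∨ b)
    Q-· : ∀ {a b} → Q a → Q b → Q (a · b)
    Q-e : Q e
    ⇒-in-Q : ∀ a b → Q (a ⇒ b)
    ⇒-sound : ∀ a b → a · (a ⇒ b) ≤ b
    ⇒-max : ∀ a b q → Q q → a · q ≤ b → q ≤ a ⇒ b

module _ {ℓ : Level} (A : SRLMonoid ℓ) where
  open SRLMonoid A

  Neg : Carrier → Set ℓ
  Neg a = a ≤ e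

  record IsSubalgebra (H : Carrier → Set ℓ) : Set ℓ where
    field
      H-∧ : ∀ {a b} → H a → H b → H (a ∧ b)
      H-∨ : ∀ {a b} → H a → H b → H (a ∨ b)
      H-· : ∀ {a b} → H a → H b → H (a · b)
      H-⇒ : ∀ {a b} → H a → H b → H (a ⇒ b)
      H-e : H e

  record IsConvexSubalgebra (H : Carrier → Set ℓ) : Set ℓ where
    field
      subalgebra : IsSubalgebra H
      convex : ∀ {a b c} → H a → H b → a ≤ c → c ≤ b → H c

  record IsStronglyConvex (H : Carrier → Set ℓ) : Set ℓ where
    field
      convexSubalgebra : IsConvexSubalgebra H
      strong : ∀ a h → H h → a · h ≤ e → e ≤ h ⇒ a → H a

  C[_] : Carrier → Carrier → Set (suc ℓ)
  C[ a ] x = ∀ (H : Carrier → Set ℓ) → IsStronglyConvex H → H a → H x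

-- Write u = e ⇒ a for a negative a.  Then u ≤ a ≤ e, u ∈ Q, and C[a] is the
-- set of x with u ^ n ≤ x and x · u ^ n ≤ e for some n: this set is a strongly
-- convex subalgebra containing a, and any strongly convex subalgebra
-- containing a contains u and its powers, hence every such x.  The identity
-- makes e ⇒ (a ∨ b) = (e ⇒ a) ∨ (e ⇒ b), and since
-- (s ∨ t) ^ (m + n) ≤ s ^ m ∨ t ^ n for negative s and t, an element bounded
-- by powers of e ⇒ a and of e ⇒ b is bounded by powers of their join.
module Submission where

open import Defs
open import Level using (Level)
open import Data.Nat as ℕ using (ℕ; zero; suc; _+_; _⊔_; z≤n; s≤s)
open import Data.Nat.Properties using (+-suc; m≤m⊔n; m≤n⊔m)
open import Data.Product using (_×_; _,_; ∃-syntax)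
open import Function.Bundles using (_⇔_; mk⇔)
open import Relation.Binary.PropositionalEquality
  using (_≡_; sym; cong; subst; isEquivalence)
open import Relation.Binary.Bundles using (Poset)
open import Algebra.Bundles using (CommutativeMonoid)
open import Algebra.Structures using (IsCommutativeMonoid)
open import Algebra.Lattice.Bundles using (Lattice)
open import Algebra.Consequences.Propositional using (comm∧distrʳ⇒distrˡ)
import Algebra.Lattice.Properties.Lattice as LatticeProperties
import Algebra.Properties.CommutativeSemigroup as CommutativeSemigroupProperties
import Algebra.Properties.Monoid.Mult as MonoidMult
import Relation.Binary.Lattice as OrderLattice
import Relation.Binary.Reasoning.PartialOrder as PartialOrderReasoning

module SRLMonoidProperties {ℓ : Level} (A : SRLMonoid ℓ) where
  open SRLMonoid A
  open IsCommutativeMonoid isCommutativeMonoid using (assoc; comm; identityˡ; identityʳ)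

  lattice : Lattice ℓ ℓ
  lattice = record { isLattice = isLattice }

  -- The standard library orders a lattice by x ≡ x ∧ y, the symmetric form of _≤_.
  private
    module L = OrderLattice.Lattice (LatticeProperties.∨-∧-orderTheoreticLattice lattice)

  poset : Poset ℓ ℓ ℓ
  poset = record
    { _≤_ = _≤_
    ; isPartialOrder = record
      { isPreorder = record
        { isEquivalence = isEquivalence
        ; reflexive = λ p → sym (L.reflexive p)
        ; trans = λ p q → sym (L.trans (sym p) (sym q))
        }
      ; antisym = λ p q → L.antisym (sym p) (sym q)
      }
    }

  open Poset poset public using ()
    renaming (refl to ≤-refl; reflexive to ≤-reflexive; trans to ≤-trans; antisym to ≤-antisym)
  open PartialOrderReasoning poset

  x≤x∨y : ∀ x y → x ≤ x ∨ y
  x≤x∨y x y = sym (L.x≤x∨y x y)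

  y≤x∨y : ∀ x y → y ≤ x ∨ y
  y≤x∨y x y = sym (L.y≤x∨y x y)

  ∨-least : ∀ {x y z} → x ≤ z → y ≤ z → x ∨ y ≤ z
  ∨-least p q = sym (L.∨-least (sym p) (sym q))

  x∧y≤x : ∀ x y → x ∧ y ≤ x
  x∧y≤x x y = sym (L.x∧y≤x x y)

  ∧-greatest : ∀ {x y z} → x ≤ y → x ≤ z → x ≤ y ∧ z
  ∧-greatest p q = sym (L.∧-greatest (sym p) (sym q))

  ≤⇒∨≡ : ∀ {x y} → x ≤ y → x ∨ y ≡ y
  ≤⇒∨≡ {x} {y} p = ≤-antisym (∨-least p ≤-refl) (y≤x∨y x y)

  ·-distribʳ-∨ : ∀ c a b → (a ∨ b) · c ≡ (a · c) ∨ (b · c)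
  ·-distribʳ-∨ c a b = ·-distrib-∨ a b c

  ·-distribˡ-∨ : ∀ c a b → c · (a ∨ b) ≡ (c · a) ∨ (c · b)
  ·-distribˡ-∨ = comm∧distrʳ⇒distrˡ comm ·-distribʳ-∨

  ·-monoˡ-≤ : ∀ c {a b} → a ≤ b → a · c ≤ b · c
  ·-monoˡ-≤ c {a} {b} a≤b = begin
    a · c             ≤⟨ x≤x∨y _ _ ⟩
    a · c ∨ b · c     ≡⟨ ·-distribʳ-∨ c a b ⟨
    (a ∨ b) · c       ≡⟨ cong (_· c) (≤⇒∨≡ a≤b) ⟩
    b · c             ∎

  ·-monoʳ-≤ : ∀ c {a b} → a ≤ b → c · a ≤ c · b
  ·-monoʳ-≤ c {a} {b} a≤b = begin
    c · a   ≡⟨ comm c a ⟩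
    a · c   ≤⟨ ·-monoˡ-≤ c a≤b ⟩
    b · c   ≡⟨ comm b c ⟩
    c · b   ∎

  ·-mono-≤ : ∀ {a b c d} → a ≤ b → c ≤ d → a · c ≤ b · d
  ·-mono-≤ {b = b} {c} a≤b c≤d = ≤-trans (·-monoˡ-≤ c a≤b) (·-monoʳ-≤ b c≤d)

  n·x≤x : ∀ x {n} → n ≤ e → n · x ≤ x
  n·x≤x x n≤e = ≤-trans (·-monoˡ-≤ x n≤e) (≤-reflexive (identityˡ x))

  neg-· : ∀ {x y} → x ≤ e → y ≤ e → x · y ≤ e
  neg-· {y = y} x≤e y≤e = ≤-trans (n·x≤x y x≤e) y≤e

  ≤⇒e≤⇒ : ∀ {h a} → h ≤ a → e ≤ h ⇒ a
  ≤⇒e≤⇒ {h} {a} h≤a = ⇒-max h a e Q-e (≤-trans (≤-reflexive (identityʳ h)) h≤a)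

  e≤⇒⇒≤ : ∀ {h a} → e ≤ h ⇒ a → h ≤ a
  e≤⇒⇒≤ {h} {a} e≤h⇒a = begin
    h             ≡⟨ identityʳ h ⟨
    h · e         ≤⟨ ·-monoʳ-≤ h e≤h⇒a ⟩
    h · (h ⇒ a)   ≤⟨ ⇒-sound h a ⟩
    a             ∎

  e⇒a≤a : ∀ a → e ⇒ a ≤ a
  e⇒a≤a a = ≤-trans (≤-reflexive (sym (identityˡ (e ⇒ a)))) (⇒-sound e a)

  e⇒-neg : ∀ {a} → a ≤ e → e ⇒ a ≤ e
  e⇒-neg {a} a≤e = ≤-trans (e⇒a≤a a) a≤e

  ·-commutativeMonoid : CommutativeMonoid ℓ ℓ
  ·-commutativeMonoid = record { isCommutativeMonoid = isCommutativeMonoid }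

  open CommutativeMonoid ·-commutativeMonoid using (monoid; commutativeSemigroup)
  open CommutativeSemigroupProperties commutativeSemigroup using (interchange)
  open MonoidMult monoid using (×-homo-+) renaming (_×_ to _times_)

  infixl 9 _^_

  _^_ : Carrier → ℕ → Carrier
  u ^ n = n times u

  ^-+ : ∀ u m n → u ^ (m + n) ≡ u ^ m · u ^ n
  ^-+ = ×-homo-+

  ^-closed : (P : Carrier → Set ℓ) → P e → (∀ {x y} → P x → P y → P (x · y)) →
             ∀ {u} n → P u → P (u ^ n)
  ^-closed P Pe P· zero    Pu = Pe
  ^-closed P Pe P· (suc n) Pu = P· Pu (^-closed P Pe P· n Pu)

  ^-neg : ∀ {u} n → u ≤ e → u ^ n ≤ e
  ^-neg = ^-closed (_≤ e) ≤-refl neg-·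

  ^-antitone : ∀ {u m n} → u ≤ e → m ℕ.≤ n → u ^ n ≤ u ^ m
  ^-antitone {n = n} u≤e z≤n       = ^-neg n u≤e
  ^-antitone {u}     u≤e (s≤s m≤n) = ·-monoʳ-≤ u (^-antitone u≤e m≤n)

  ·-∨-≤ˡ : ∀ {s} p q → s ≤ e → s · (p ∨ q) ≤ s · p ∨ q
  ·-∨-≤ˡ {s} p q s≤e = begin
    s · (p ∨ q)     ≡⟨ ·-distribˡ-∨ s p q ⟩
    s · p ∨ s · q   ≤⟨ ∨-least (x≤x∨y _ _) (≤-trans (n·x≤x q s≤e) (y≤x∨y _ _)) ⟩
    s · p ∨ q       ∎

  ·-∨-≤ʳ : ∀ {t} p q → t ≤ e → t · (p ∨ q) ≤ p ∨ t · q
  ·-∨-≤ʳ {t} p q t≤e = begin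
    t · (p ∨ q)     ≡⟨ ·-distribˡ-∨ t p q ⟩
    t · p ∨ t · q   ≤⟨ ∨-least (≤-trans (n·x≤x p t≤e) (x≤x∨y _ _)) (y≤x∨y _ _) ⟩
    p ∨ t · q       ∎

  -- Each monomial of (s ∨ t) ^ (m + n) has at least m factors s or n factors t.
  ^-∨-≤ : ∀ {s t} → s ≤ e → t ≤ e → ∀ m n → (s ∨ t) ^ (m + n) ≤ s ^ m ∨ t ^ n
  ^-∨-≤ s≤e t≤e zero    n    = ≤-trans (^-neg n (∨-least s≤e t≤e)) (x≤x∨y _ _)
  ^-∨-≤ s≤e t≤e (suc m) zero = ≤-trans (^-neg (suc m + 0) (∨-least s≤e t≤e)) (y≤x∨y _ _)
  ^-∨-≤ {s} {t} s≤e t≤e (suc m) (suc n) = begin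
    (s ∨ t) · P       ≡⟨ ·-distribʳ-∨ P s t ⟩
    s · P ∨ t · P     ≤⟨ ∨-least s·P≤ t·P≤ ⟩
    s ^ suc m ∨ t ^ suc n ∎
    where
    P : Carrier
    P = (s ∨ t) ^ (m + suc n)

    s·P≤ : s · P ≤ s ^ suc m ∨ t ^ suc n
    s·P≤ = ≤-trans (·-monoʳ-≤ s (^-∨-≤ s≤e t≤e m (suc n))) (·-∨-≤ˡ _ _ s≤e)

    t·P≤ : t · P ≤ s ^ suc m ∨ t ^ suc n
    t·P≤ = begin
      t · P                       ≡⟨ cong (λ k → t · (s ∨ t) ^ k) (+-suc m n) ⟩
      t · (s ∨ t) ^ (suc m + n)   ≤⟨ ·-monoʳ-≤ t (^-∨-≤ s≤e t≤e (suc m) n) ⟩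
      t · (s ^ suc m ∨ t ^ n)     ≤⟨ ·-∨-≤ʳ _ _ t≤e ⟩
      s ^ suc m ∨ t ^ suc n       ∎

  record BoundedBy (u : Carrier) (n : ℕ) (x : Carrier) : Set ℓ where
    constructor bounded
    field
      lower : u ^ n ≤ x
      upper : x · u ^ n ≤ e

  PowerBounded : Carrier → Carrier → Set ℓ
  PowerBounded u x = ∃[ n ] BoundedBy u n x

  boundedBy-mono : ∀ {u m n x} → u ≤ e → m ℕ.≤ n → BoundedBy u m x → BoundedBy u n x
  boundedBy-mono {u} {m} {n} {x} u≤e m≤n (bounded lower upper) =
    bounded (≤-trans uⁿ≤uᵐ lower) (≤-trans (·-monoʳ-≤ x uⁿ≤uᵐ) upper)
    where
    uⁿ≤uᵐ : u ^ n ≤ u ^ m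
    uⁿ≤uᵐ = ^-antitone u≤e m≤n

  common-bound : ∀ {u x y} → u ≤ e → PowerBounded u x → PowerBounded u y →
                 ∃[ n ] BoundedBy u n x × BoundedBy u n y
  common-bound u≤e (m , x-bd) (n , y-bd) =
    m ⊔ n , boundedBy-mono u≤e (m≤m⊔n m n) x-bd , boundedBy-mono u≤e (m≤n⊔m m n) y-bd

  powerBounded-closed₂ : ∀ {u} (f : ℕ → ℕ) (_∙_ : Carrier → Carrier → Carrier) → u ≤ e →
    (∀ {n x y} → BoundedBy u n x → BoundedBy u n y → BoundedBy u (f n) (x ∙ y)) →
    ∀ {x y} → PowerBounded u x → PowerBounded u y → PowerBounded u (x ∙ y)
  powerBounded-closed₂ f _∙_ u≤e closed x-pb y-pb =
    let n , x-bd , y-bd = common-bound u≤e x-pb y-pb in f n , closed x-bd y-bd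

  boundedBy-∧ : ∀ {u n x y} → BoundedBy u n x → BoundedBy u n y → BoundedBy u n (x ∧ y)
  boundedBy-∧ {u} {n} {x} {y} (bounded x-lower x-upper) (bounded y-lower _) =
    bounded (∧-greatest x-lower y-lower) (≤-trans (·-monoˡ-≤ (u ^ n) (x∧y≤x x y)) x-upper)

  boundedBy-∨ : ∀ {u n x y} → BoundedBy u n x → BoundedBy u n y → BoundedBy u n (x ∨ y)
  boundedBy-∨ {u} {n} {x} {y} (bounded x-lower x-upper) (bounded _ y-upper) =
    bounded (≤-trans x-lower (x≤x∨y x y))
            (≤-trans (≤-reflexive (·-distribʳ-∨ (u ^ n) x y)) (∨-least x-upper y-upper))

  boundedBy-· : ∀ {u n x y} → BoundedBy u n x → BoundedBy u n y → BoundedBy u (n + n) (x · y)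
  boundedBy-· {u} {n} {x} {y} (bounded x-lower x-upper) (bounded y-lower y-upper) =
    bounded lower upper
    where
    lower : u ^ (n + n) ≤ x · y
    lower = ≤-trans (≤-reflexive (^-+ u n n)) (·-mono-≤ x-lower y-lower)

    upper : (x · y) · u ^ (n + n) ≤ e
    upper = begin
      (x · y) · u ^ (n + n)           ≡⟨ cong ((x · y) ·_) (^-+ u n n) ⟩
      (x · y) · (u ^ n · u ^ n)       ≡⟨ interchange x y (u ^ n) (u ^ n) ⟩
      (x · u ^ n) · (y · u ^ n)       ≤⟨ neg-· x-upper y-upper ⟩
      e                               ∎

  boundedBy-⇒ : ∀ {u n x y} → Q u → BoundedBy u n x → BoundedBy u n y →
                BoundedBy u (n + n) (x ⇒ y)
  boundedBy-⇒ {u} {n} {x} {y} u∈Q (bounded x-lower x-upper) (bounded y-lower y-upper) =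
    bounded lower upper
    where
    uⁿ∈Q : Q (u ^ n)
    uⁿ∈Q = ^-closed Q Q-e Q-· n u∈Q

    x·u²ⁿ≤y : x · (u ^ n · u ^ n) ≤ y
    x·u²ⁿ≤y = begin
      x · (u ^ n · u ^ n)   ≡⟨ assoc x (u ^ n) (u ^ n) ⟨
      (x · u ^ n) · u ^ n   ≤⟨ ·-monoˡ-≤ (u ^ n) x-upper ⟩
      e · u ^ n             ≡⟨ identityˡ (u ^ n) ⟩
      u ^ n                 ≤⟨ y-lower ⟩
      y                     ∎

    lower : u ^ (n + n) ≤ x ⇒ y
    lower = ≤-trans (≤-reflexive (^-+ u n n)) (⇒-max x y _ (Q-· uⁿ∈Q uⁿ∈Q) x·u²ⁿ≤y)

    upper : (x ⇒ y) · u ^ (n + n) ≤ e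
    upper = begin
      (x ⇒ y) · u ^ (n + n)         ≡⟨ cong ((x ⇒ y) ·_) (^-+ u n n) ⟩
      (x ⇒ y) · (u ^ n · u ^ n)     ≡⟨ assoc (x ⇒ y) (u ^ n) (u ^ n) ⟨
      ((x ⇒ y) · u ^ n) · u ^ n     ≤⟨ ·-monoˡ-≤ (u ^ n) (·-monoʳ-≤ (x ⇒ y) x-lower) ⟩
      ((x ⇒ y) · x) · u ^ n         ≡⟨ cong (_· u ^ n) (comm (x ⇒ y) x) ⟩
      (x · (x ⇒ y)) · u ^ n         ≤⟨ ·-monoˡ-≤ (u ^ n) (⇒-sound x y) ⟩
      y · u ^ n                     ≤⟨ y-upper ⟩
      e                             ∎

  powerBounded-isStronglyConvex : ∀ {u} → Q u → u ≤ e → IsStronglyConvex A (PowerBounded u)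
  powerBounded-isStronglyConvex {u} u∈Q u≤e = record
    { convexSubalgebra = record
      { subalgebra = record
        { H-∧ = powerBounded-closed₂ (λ n → n) _∧_ u≤e boundedBy-∧
        ; H-∨ = powerBounded-closed₂ (λ n → n) _∨_ u≤e boundedBy-∨
        ; H-· = powerBounded-closed₂ (λ n → n + n) _·_ u≤e boundedBy-·
        ; H-⇒ = powerBounded-closed₂ (λ n → n + n) _⇒_ u≤e (boundedBy-⇒ u∈Q)
        ; H-e = 0 , bounded ≤-refl (≤-reflexive (identityʳ e))
        }
      ; convex = convex
      }
    ; strong = strong
    }
    where
    convex : ∀ {a b c} → PowerBounded u a → PowerBounded u b → a ≤ c → c ≤ b →
             PowerBounded u c
    convex a-pb b-pb a≤c c≤b =
      let n , bounded a-lower _ , bounded _ b-upper = common-bound u≤e a-pb b-pb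
      in  n , bounded (≤-trans a-lower a≤c) (≤-trans (·-monoˡ-≤ (u ^ n) c≤b) b-upper)

    strong : ∀ a h → PowerBounded u h → a · h ≤ e → e ≤ h ⇒ a → PowerBounded u a
    strong a h (n , bounded h-lower _) a·h≤e e≤h⇒a =
      n , bounded (≤-trans h-lower (e≤⇒⇒≤ e≤h⇒a)) (≤-trans (·-monoʳ-≤ a h-lower) a·h≤e)

  powerBounded⊆ : ∀ {H u x} → IsStronglyConvex A H → H u → PowerBounded u x → H x
  powerBounded⊆ {H} {u} {x} H-sc u∈H (n , bounded lower upper) =
    strong x (u ^ n) (^-closed H H-e H-· n u∈H) upper (≤⇒e≤⇒ lower)
    where
    open IsStronglyConvex H-sc
    open IsConvexSubalgebra convexSubalgebra
    open IsSubalgebra subalgebra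

  C[]⊆powerBounded : ∀ {a x} → a ≤ e → C[_] A a x → PowerBounded (e ⇒ a) x
  C[]⊆powerBounded {a} a≤e x∈C[a] =
    x∈C[a] (PowerBounded (e ⇒ a)) pb-isStronglyConvex a-pb
    where
    pb-isStronglyConvex : IsStronglyConvex A (PowerBounded (e ⇒ a))
    pb-isStronglyConvex = powerBounded-isStronglyConvex (⇒-in-Q e a) (e⇒-neg a≤e)

    a-pb : PowerBounded (e ⇒ a) a
    a-pb = 1 , bounded (≤-trans (≤-reflexive (identityʳ (e ⇒ a))) (e⇒a≤a a))
                       (neg-· a≤e (^-neg 1 (e⇒-neg a≤e)))

  powerBounded⊆C[] : ∀ {a x} → PowerBounded (e ⇒ a) x → C[_] A a x
  powerBounded⊆C[] x-pb H H-sc a∈H = powerBounded⊆ H-sc (H-⇒ H-e a∈H) x-pb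
    where open IsSubalgebra (IsConvexSubalgebra.subalgebra (IsStronglyConvex.convexSubalgebra H-sc))

  C[]-antitone : ∀ {a b x} → a ≤ b → b ≤ e → C[_] A b x → C[_] A a x
  C[]-antitone a≤b b≤e x∈C[b] H H-sc a∈H = x∈C[b] H H-sc (convex a∈H H-e a≤b b≤e)
    where
    open IsConvexSubalgebra (IsStronglyConvex.convexSubalgebra H-sc)
    open IsSubalgebra subalgebra

  powerBounded-∨ : ∀ {s t x} → s ≤ e → t ≤ e →
                   PowerBounded s x → PowerBounded t x → PowerBounded (s ∨ t) x
  powerBounded-∨ {s} {t} {x} s≤e t≤e
                 (m , bounded s-lower s-upper) (n , bounded t-lower t-upper) =
    m + n , bounded (≤-trans join-bound (∨-least s-lower t-lower)) upper
    where
    join-bound : (s ∨ t) ^ (m + n) ≤ s ^ m ∨ t ^ n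
    join-bound = ^-∨-≤ s≤e t≤e m n

    upper : x · (s ∨ t) ^ (m + n) ≤ e
    upper = begin
      x · (s ∨ t) ^ (m + n)       ≤⟨ ·-monoʳ-≤ x join-bound ⟩
      x · (s ^ m ∨ t ^ n)         ≡⟨ ·-distribˡ-∨ x (s ^ m) (t ^ n) ⟩
      x · s ^ m ∨ x · t ^ n       ≤⟨ ∨-least s-upper t-upper ⟩
      e                           ∎

lemma5p2 : {ℓ : Level} (A : SRLMonoid ℓ) →
    (∀ x y z → SRLMonoid._⇒_ A z (SRLMonoid._∨_ A x y)
                 ≡ SRLMonoid._∨_ A (SRLMonoid._⇒_ A z x) (SRLMonoid._⇒_ A z y)) →
    ∀ a b → Neg A a → Neg A b →
    ∀ x → C[_] A (SRLMonoid._∨_ A a b) x ⇔ (C[_] A a x × C[_] A b x)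
lemma5p2 A ⇒-distrib-∨ a b a≤e b≤e x = mk⇔ to from
  where
  open SRLMonoid A
  open SRLMonoidProperties A

  a∨b≤e : a ∨ b ≤ e
  a∨b≤e = ∨-least a≤e b≤e

  to : C[_] A (a ∨ b) x → C[_] A a x × C[_] A b x
  to x∈C[a∨b] = C[]-antitone (x≤x∨y a b) a∨b≤e x∈C[a∨b] ,
                C[]-antitone (y≤x∨y a b) a∨b≤e x∈C[a∨b]

  from : C[_] A a x × C[_] A b x → C[_] A (a ∨ b) x
  from (x∈C[a] , x∈C[b]) =
    powerBounded⊆C[] (subst (λ u → PowerBounded u x) (sym (⇒-distrib-∨ a b e)) x-pb)
    where
    x-pb : PowerBounded ((e ⇒ a) ∨ (e ⇒ b)) x
    x-pb = powerBounded-∨ (e⇒-neg a≤e) (e⇒-neg b≤e)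
             (C[]⊆powerBounded a≤e x∈C[a]) (C[]⊆powerBounded b≤e x∈C[b])
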